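{- Consider unit-demand CVRP with capacity $k\ge3$, let $I^*$ be an optimal itinerary in which each tour is a simple cycle through $v_0$ visiting exactly $k$ customers, let $\chi=w(h(I^*))/w(I^*)$, and let $\mathrm{MST}$ denote the total weight of a minimum spanning tree of $G$. Then $\left(1-\frac{1}{2}\chi\right)w(I^*)\geq\mathrm{MST}$.
   Context: Unit-demand CVRP: complete graph $G$ on $V\cup\{v_0\}$ ($V=\{v_1,\dots,v_n\}$ customers each of demand 1, $v_0$ depot), nonnegative symmetric edge weight $w$ satisfying the triangle inequality, capacity $k$; a tour is a cycle through $v_0$ serving at most $k$ customers; an itinerary is a set of tours serving all customers, with weight $w(I)$ the total weight of its edges. Standing assumption of the paper: there is an optimal itinerary $I^*$ in which every tour is a simple cycle $(v_0,u_1,\dots,u_k,v_0)$ serving exactly $k$ customers (tours pairwise meet only at $v_0$). Home-edges: the edges of $I^*$ incident to $v_0$; $h(I^*)$ denotes their set; $w(I^*)>0$ is assumed.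
   Formalization: The edge weights w take values in the rationals rather than the reals. -}

module Defs where

open import Data.Nat using (ℕ; zero; suc)
import Data.Nat as ℕ
open import Data.Fin using (Fin; zero; suc)
open import Data.List using (List; []; _∷_; length; concat; map; foldr; allFin)
open import Data.List.Relation.Unary.All using (All)
open import Data.List.Membership.Propositional using (_∈_)
open import Data.List.Relation.Binary.Permutation.Propositional using (_↭_)
open import Data.Product using (_×_; _,_; Σ)
open import Data.Rational using (ℚ; 0ℚ; _+_; _≤_; _<_; _÷_; NonZero; positive)
open import Data.Rational.Properties using (pos⇒nonZero)
open import Relation.Binary.PropositionalEquality using (_≡_)

-- Vertices of G: Fin (suc n); the depot v₀ is `zero`, customer vᵢ (i = 1..n)
-- is `suc c` for c : Fin n.
Vertex : ℕ → Set
Vertex n = Fin (suc n)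

depot : ∀ {n} → Vertex n
depot = zero

cust : ∀ {n} → Fin n → Vertex n
cust = suc

Weight : ℕ → Set
Weight n = Vertex n → Vertex n → ℚ

IsMetricWeight : ∀ {n} → Weight n → Set
IsMetricWeight {n} w =
  (∀ x y → 0ℚ ≤ w x y) ×
  (∀ x y → w x y ≡ w y x) ×
  (∀ x y z → w x z ≤ w x y + w y z)

-- A tour is given by the sequence of customers it visits (in order):
-- the closed walk v₀ → u₁ → … → u_j → v₀.
Tour : ℕ → Set
Tour n = List (Fin n)

walkBack : ∀ {n} → Weight n → Vertex n → List (Fin n) → ℚ
walkBack w a [] = w a depot
walkBack w a (x ∷ xs) = w a (cust x) + walkBack w (cust x) xs

tourWeight : ∀ {n} → Weight n → Tour n → ℚ
tourWeight w t = walkBack w depot t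

Itinerary : ℕ → Set
Itinerary n = List (Tour n)

sumℚ : List ℚ → ℚ
sumℚ = foldr _+_ 0ℚ

itinWeight : ∀ {n} → Weight n → Itinerary n → ℚ
itinWeight w I = sumℚ (map (tourWeight w) I)

IsItinerary : ∀ {n} → ℕ → Itinerary n → Set
IsItinerary {n} k I =
  All (λ t → 1 ℕ.≤ length t × length t ℕ.≤ k) I ×
  (∀ (c : Fin n) → Σ (Tour n) (λ t → t ∈ I × c ∈ t))

IsOptimal : ∀ {n} → Weight n → ℕ → Itinerary n → Set
IsOptimal {n} w k I =
  IsItinerary k I × (∀ (J : Itinerary n) → IsItinerary k J → itinWeight w I ≤ itinWeight w J)

-- Standing assumption: each tour is a simple cycle (v₀,u₁,…,u_k,v₀) serving
-- exactly k customers, and tours pairwise meet only at v₀. Equivalently: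
-- every tour has exactly k customers, and the concatenation of all tours is a
-- permutation of the customer set (each customer occurs exactly once overall).
ExactSimpleTours : ∀ {n} → ℕ → Itinerary n → Set
ExactSimpleTours {n} k I =
  All (λ t → length t ≡ k) I × (concat I ↭ allFin n)

lastOr : ∀ {A : Set} → A → List A → A
lastOr d [] = d
lastOr d (x ∷ xs) = lastOr x xs

homeWeightTour : ∀ {n} → Weight n → Tour n → ℚ
homeWeightTour w [] = 0ℚ
homeWeightTour w (x ∷ xs) = w depot (cust x) + w (cust (lastOr x xs)) depot

homeWeight : ∀ {n} → Weight n → Itinerary n → ℚ
homeWeight w I = sumℚ (map (homeWeightTour w) I)

chi : ∀ {n} → (w : Weight n) → (I : Itinerary n) → 0ℚ < itinWeight w I → ℚ
chi w I pos =
  _÷_ (homeWeight w I) (itinWeight w I) {{pos⇒nonZero (itinWeight w I) {{positive pos}}}}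

Edge : ℕ → Set
Edge n = Vertex n × Vertex n

data Connected {n} (E : List (Edge n)) : Vertex n → Vertex n → Set where
  here : ∀ {x} → Connected E x x
  fwd  : ∀ {x y z} → (x , y) ∈ E → Connected E y z → Connected E x z
  bwd  : ∀ {x y z} → (y , x) ∈ E → Connected E y z → Connected E x z

-- A spanning tree of G (n+1 vertices): n edges connecting all vertices.
-- (A connected graph with |V|-1 edges is exactly a tree.)
IsSpanningTree : ∀ {n} → List (Edge n) → Set
IsSpanningTree {n} E = length E ≡ n × (∀ x y → Connected E x y)

edgesWeight : ∀ {n} → Weight n → List (Edge n) → ℚ
edgesWeight w E = sumℚ (map (λ e → w (Data.Product.proj₁ e) (Data.Product.proj₂ e)) E)

IsMST : ∀ {n} → Weight n → List (Edge n) → Set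
IsMST {n} w T = IsSpanningTree T × (∀ (T' : List (Edge n)) → IsSpanningTree T' → edgesWeight w T ≤ edgesWeight w T')

{-# OPTIONS --safe #-}
-- Deleting the return edge of every tour of I* leaves n edges that join every customer to v₀
-- (a star of Hamiltonian paths), hence a spanning tree; so does deleting the departure edge of
-- every tour. Every tour edge lies in both trees except the two home edges, which lie in exactly
-- one, so the two trees weigh 2 w(I*) − w(h(I*)) together, and MST ≤ w(I*) − w(h(I*))/2.
module Submission where

open import Defs
open import Data.Nat using (ℕ; suc)
import Data.Nat as ℕ
open import Data.List using (List; []; _∷_; _++_; length; concat; map; allFin)
open import Data.List.Properties using (length-++; length-tabulate; map-++)
open import Data.List.Relation.Unary.All as All using (All; []; _∷_)
open import Data.List.Relation.Unary.Any using (here; there)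
open import Data.List.Membership.Propositional using (_∈_)
open import Data.List.Membership.Propositional.Properties using (∈-map⁺; ∈-concat⁺′)
open import Data.List.Relation.Binary.Permutation.Propositional using (_↭_)
open import Data.List.Relation.Binary.Permutation.Propositional.Properties using (↭-length)
open import Data.Fin using (Fin; zero; suc)
open import Data.Product using (Σ; _×_; _,_; proj₁)
open import Data.Rational using (ℚ; 0ℚ; 1ℚ; ½; _*_; _-_; _+_; _÷_; 1/_; _≤_; _<_; NonZero; positive)
open import Data.Rational.Properties
  using ( *-monoˡ-≤-nonNeg; +-mono-≤; *-inverseˡ; pos⇒nonZero
        ; +-assoc; +-identityˡ; +-identityʳ; *-identityʳ; module ≤-Reasoning )
open import Data.Rational.Solver using (module +-*-Solver)
open import Relation.Binary.PropositionalEquality using (_≡_; refl; cong; cong₂; sym; trans; module ≡-Reasoning)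

open +-*-Solver

sumℚ-++ : (xs ys : List ℚ) → sumℚ (xs ++ ys) ≡ sumℚ xs + sumℚ ys
sumℚ-++ []       ys = sym (+-identityˡ (sumℚ ys))
sumℚ-++ (x ∷ xs) ys = trans (cong (x +_) (sumℚ-++ xs ys)) (sym (+-assoc x (sumℚ xs) (sumℚ ys)))

length-concat-map : ∀ {A B : Set} (f : List A → List B) → (∀ xs → length (f xs) ≡ length xs) →
                    ∀ xss → length (concat (map f xss)) ≡ length (concat xss)
length-concat-map f f-length []         = refl
length-concat-map f f-length (xs ∷ xss) = begin
  length (f xs ++ concat (map f xss))
    ≡⟨ length-++ (f xs) ⟩
  length (f xs) ℕ.+ length (concat (map f xss))
    ≡⟨ cong₂ ℕ._+_ (f-length xs) (length-concat-map f f-length xss) ⟩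
  length xs ℕ.+ length (concat xss)
    ≡⟨ sym (length-++ xs) ⟩
  length (xs ++ concat xss)
    ∎
  where open ≡-Reasoning

≤-½-sum : ∀ {m a b} → m ≤ a → m ≤ b → m ≤ ½ * (a + b)
≤-½-sum {m} {a} {b} m≤a m≤b = begin
  m            ≡⟨ solve 1 (λ m → m := con ½ :* (m :+ m)) refl m ⟩
  ½ * (m + m)  ≤⟨ *-monoˡ-≤-nonNeg ½ (+-mono-≤ m≤a m≤b) ⟩
  ½ * (a + b)  ∎
  where open ≤-Reasoning

½-sum-of-complements : ∀ a b h s → a + b + h ≡ s + s → ½ * (a + b) ≡ s - ½ * h
½-sum-of-complements a b h s eq = begin
  ½ * (a + b)
    ≡⟨ solve 3 (λ a b h → con ½ :* (a :+ b) := con ½ :* (a :+ b :+ h) :- con ½ :* h) refl a b h ⟩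
  ½ * (a + b + h) - ½ * h
    ≡⟨ cong (λ z → ½ * z - ½ * h) eq ⟩
  ½ * (s + s) - ½ * h
    ≡⟨ solve 2 (λ s h → con ½ :* (s :+ s) :- con ½ :* h := s :- con ½ :* h) refl s h ⟩
  s - ½ * h
    ∎
  where open ≡-Reasoning

sub-½-ratio : ∀ h s .{{_ : NonZero s}} → s - ½ * h ≡ (1ℚ - ½ * (h ÷ s)) * s
sub-½-ratio h s = begin
  s - ½ * h
    ≡⟨ cong (λ z → s - z) (sym (*-identityʳ (½ * h))) ⟩
  s - ½ * h * 1ℚ
    ≡⟨ cong (λ z → s - ½ * h * z) (sym (*-inverseˡ s)) ⟩
  s - ½ * h * (1/ s * s)
    ≡⟨ solve 3 (λ s h r → s :- con ½ :* h :* (r :* s) := (con 1ℚ :- con ½ :* (h :* r)) :* s) refl s h (1/ s) ⟩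
  (1ℚ - ½ * (h ÷ s)) * s
    ∎
  where open ≡-Reasoning

module _ {n : ℕ} where

  connected-mono : ∀ {E F : List (Edge n)} → (∀ {e} → e ∈ E → e ∈ F) →
                   ∀ {x y} → Connected E x y → Connected F x y
  connected-mono E⊆F here      = here
  connected-mono E⊆F (fwd e p) = fwd (E⊆F e) (connected-mono E⊆F p)
  connected-mono E⊆F (bwd e p) = bwd (E⊆F e) (connected-mono E⊆F p)

  connected-trans : ∀ {E : List (Edge n)} {x y z} → Connected E x y → Connected E y z → Connected E x z
  connected-trans here      q = q
  connected-trans (fwd e p) q = fwd e (connected-trans p q)
  connected-trans (bwd e p) q = bwd e (connected-trans p q)

  connected-sym : ∀ {E : List (Edge n)} {x y} → Connected E x y → Connected E y x
  connected-sym here      = here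
  connected-sym (fwd e p) = connected-trans (connected-sym p) (bwd e here)
  connected-sym (bwd e p) = connected-trans (connected-sym p) (fwd e here)

  pathEdges : Vertex n → List (Fin n) → List (Edge n)
  pathEdges a []       = []
  pathEdges a (x ∷ xs) = (a , cust x) ∷ pathEdges (cust x) xs

  returnEdges : Vertex n → List (Fin n) → List (Edge n)
  returnEdges a []       = (a , depot) ∷ []
  returnEdges a (x ∷ xs) = (a , cust x) ∷ returnEdges (cust x) xs

  withoutReturnEdge : Tour n → List (Edge n)
  withoutReturnEdge = pathEdges depot

  withoutDepartureEdge : Tour n → List (Edge n)
  withoutDepartureEdge []       = []
  withoutDepartureEdge (x ∷ xs) = returnEdges (cust x) xs

  length-pathEdges : ∀ a xs → length (pathEdges a xs) ≡ length xs
  length-pathEdges a []       = refl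
  length-pathEdges a (x ∷ xs) = cong suc (length-pathEdges (cust x) xs)

  length-returnEdges : ∀ a xs → length (returnEdges a xs) ≡ suc (length xs)
  length-returnEdges a []       = refl
  length-returnEdges a (x ∷ xs) = cong suc (length-returnEdges (cust x) xs)

  length-withoutReturnEdge : ∀ t → length (withoutReturnEdge t) ≡ length t
  length-withoutReturnEdge = length-pathEdges depot

  length-withoutDepartureEdge : ∀ t → length (withoutDepartureEdge t) ≡ length t
  length-withoutDepartureEdge []       = refl
  length-withoutDepartureEdge (x ∷ xs) = length-returnEdges (cust x) xs

  pathEdges-connects : ∀ a xs {c} → c ∈ xs → Connected (pathEdges a xs) a (cust c)
  pathEdges-connects a (x ∷ xs) (here refl) = fwd (here refl) here
  pathEdges-connects a (x ∷ xs) (there c∈xs) =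
    fwd (here refl) (connected-mono there (pathEdges-connects (cust x) xs c∈xs))

  returnEdges-connects-start : ∀ a xs → Connected (returnEdges a xs) a depot
  returnEdges-connects-start a []       = fwd (here refl) here
  returnEdges-connects-start a (x ∷ xs) =
    fwd (here refl) (connected-mono there (returnEdges-connects-start (cust x) xs))

  returnEdges-connects : ∀ a xs {c} → c ∈ xs → Connected (returnEdges a xs) (cust c) depot
  returnEdges-connects a (x ∷ xs) (here refl)  = connected-mono there (returnEdges-connects-start (cust x) xs)
  returnEdges-connects a (x ∷ xs) (there c∈xs) = connected-mono there (returnEdges-connects (cust x) xs c∈xs)

  withoutReturnEdge-connects : ∀ t {c} → c ∈ t → Connected (withoutReturnEdge t) (cust c) depot
  withoutReturnEdge-connects t c∈t = connected-sym (pathEdges-connects depot t c∈t)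

  withoutDepartureEdge-connects : ∀ t {c} → c ∈ t → Connected (withoutDepartureEdge t) (cust c) depot
  withoutDepartureEdge-connects (x ∷ xs) (here refl)  = returnEdges-connects-start (cust x) xs
  withoutDepartureEdge-connects (x ∷ xs) (there c∈xs) = returnEdges-connects (cust x) xs c∈xs

  concat-map-isSpanningTree :
    (f : Tour n → List (Edge n)) → (∀ t → length (f t) ≡ length t) →
    (∀ t {c} → c ∈ t → Connected (f t) (cust c) depot) →
    (I : Itinerary n) → concat I ↭ allFin n → (∀ c → Σ (Tour n) λ t → t ∈ I × c ∈ t) →
    IsSpanningTree (concat (map f I))
  concat-map-isSpanningTree f f-length f-connects I perm covers =
    trans (length-concat-map f f-length I) (trans (↭-length perm) (length-tabulate _)) ,
    λ x y → connected-trans (toDepot x) (connected-sym (toDepot y))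
    where
      toDepot : ∀ v → Connected (concat (map f I)) v depot
      toDepot zero    = here
      toDepot (suc c) with covers c
      ... | t , t∈I , c∈t =
        connected-mono (λ e∈ft → ∈-concat⁺′ e∈ft (∈-map⁺ f t∈I)) (f-connects t c∈t)

  module _ (w : Weight n) where

    edgesWeight-++ : ∀ E F → edgesWeight w (E ++ F) ≡ edgesWeight w E + edgesWeight w F
    edgesWeight-++ E F = trans (cong sumℚ (map-++ edgeWeight E F)) (sumℚ-++ (map edgeWeight E) (map edgeWeight F))
      where
        edgeWeight : Edge n → ℚ
        edgeWeight (x , y) = w x y

    edgesWeight-returnEdges : ∀ a xs → edgesWeight w (returnEdges a xs) ≡ walkBack w a xs
    edgesWeight-returnEdges a []       = +-identityʳ (w a depot)
    edgesWeight-returnEdges a (x ∷ xs) = cong (w a (cust x) +_) (edgesWeight-returnEdges (cust x) xs)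

    walkBack-pathEdges : ∀ x xs →
      walkBack w (cust x) xs ≡ edgesWeight w (pathEdges (cust x) xs) + w (cust (lastOr x xs)) depot
    walkBack-pathEdges x []       = sym (+-identityˡ _)
    walkBack-pathEdges x (y ∷ ys) =
      trans (cong (w (cust x) (cust y) +_) (walkBack-pathEdges y ys)) (sym (+-assoc (w (cust x) (cust y)) _ _))

    tour-double-count : ∀ x xs → let t = x ∷ xs in
      edgesWeight w (withoutReturnEdge t) + edgesWeight w (withoutDepartureEdge t) + homeWeightTour w t
        ≡ tourWeight w t + tourWeight w t
    tour-double-count x xs = begin
      (d + p) + edgesWeight w (returnEdges (cust x) xs) + (d + r)
        ≡⟨ cong (λ z → (d + p) + z + (d + r)) (edgesWeight-returnEdges (cust x) xs) ⟩
      (d + p) + walkBack w (cust x) xs + (d + r)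
        ≡⟨ cong (λ z → (d + p) + z + (d + r)) (walkBack-pathEdges x xs) ⟩
      (d + p) + (p + r) + (d + r)
        ≡⟨ solve 3 (λ d p r → (d :+ p) :+ (p :+ r) :+ (d :+ r) := (d :+ (p :+ r)) :+ (d :+ (p :+ r)))
                   refl d p r ⟩
      (d + (p + r)) + (d + (p + r))
        ≡⟨ cong (λ z → (d + z) + (d + z)) (sym (walkBack-pathEdges x xs)) ⟩
      tourWeight w (x ∷ xs) + tourWeight w (x ∷ xs) ∎
      where
        open ≡-Reasoning
        d = w depot (cust x)
        p = edgesWeight w (pathEdges (cust x) xs)
        r = w (cust (lastOr x xs)) depot

    itinerary-double-count : ∀ I → All (λ t → 1 ℕ.≤ length t) I →
      edgesWeight w (concat (map withoutReturnEdge I)) + edgesWeight w (concat (map withoutDepartureEdge I))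
        + homeWeight w I ≡ itinWeight w I + itinWeight w I
    itinerary-double-count []             []               = refl
    itinerary-double-count ((x ∷ xs) ∷ I) (_ ∷ I-nonempty) = begin
      edgesWeight w (a ++ A) + edgesWeight w (b ++ B) + (h + H)
        ≡⟨ cong₂ (λ u v → u + v + (h + H)) (edgesWeight-++ a A) (edgesWeight-++ b B) ⟩
      (wa + wA) + (wb + wB) + (h + H)
        ≡⟨ solve 6 (λ wa wA wb wB h H → (wa :+ wA) :+ (wb :+ wB) :+ (h :+ H)
                                       := (wa :+ wb :+ h) :+ (wA :+ wB :+ H))
                   refl wa wA wb wB h H ⟩
      (wa + wb + h) + (wA + wB + H)
        ≡⟨ cong₂ _+_ (tour-double-count x xs) (itinerary-double-count I I-nonempty) ⟩
      (s + s) + (S + S)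
        ≡⟨ solve 2 (λ s S → (s :+ s) :+ (S :+ S) := (s :+ S) :+ (s :+ S)) refl s S ⟩
      (s + S) + (s + S) ∎
      where
        open ≡-Reasoning
        t = x ∷ xs
        a = withoutReturnEdge t
        A = concat (map withoutReturnEdge I)
        b = withoutDepartureEdge t
        B = concat (map withoutDepartureEdge I)
        wa = edgesWeight w a
        wA = edgesWeight w A
        wb = edgesWeight w b
        wB = edgesWeight w B
        h = homeWeightTour w t
        H = homeWeight w I
        s = tourWeight w t
        S = itinWeight w I

lemma7 : (n k : ℕ) → 3 ℕ.≤ k → (w : Weight n) → IsMetricWeight w →
         (Istar : Itinerary n) → IsOptimal w k Istar → ExactSimpleTours k Istar →
         (pos : 0ℚ < itinWeight w Istar) →
         (T : List (Edge n)) → IsMST w T →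
         edgesWeight w T ≤ (1ℚ - ½ * chi w Istar pos) * itinWeight w Istar
lemma7 n k _ w _ I ((tour-sizes , covers) , _) (_ , perm) pos T (_ , minimal) = begin
  edgesWeight w T
    ≤⟨ ≤-½-sum (minimal tree₁ tree₁-spanning) (minimal tree₂ tree₂-spanning) ⟩
  ½ * (edgesWeight w tree₁ + edgesWeight w tree₂)
    ≡⟨ ½-sum-of-complements (edgesWeight w tree₁) (edgesWeight w tree₂) H W trees-double-count ⟩
  W - ½ * H
    ≡⟨ sub-½-ratio H W ⟩
  (1ℚ - ½ * chi w I pos) * W
    ∎
  where
    open ≤-Reasoning
    W = itinWeight w I
    H = homeWeight w I
    instance
      _ : NonZero W
      _ = pos⇒nonZero W {{positive pos}}
    tree₁ tree₂ : List (Edge n)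
    tree₁ = concat (map withoutReturnEdge I)
    tree₂ = concat (map withoutDepartureEdge I)
    tree₁-spanning : IsSpanningTree tree₁
    tree₁-spanning = concat-map-isSpanningTree
      withoutReturnEdge length-withoutReturnEdge withoutReturnEdge-connects I perm covers
    tree₂-spanning : IsSpanningTree tree₂
    tree₂-spanning = concat-map-isSpanningTree
      withoutDepartureEdge length-withoutDepartureEdge withoutDepartureEdge-connects I perm covers
    trees-double-count : edgesWeight w tree₁ + edgesWeight w tree₂ + H ≡ W + W
    trees-double-count = itinerary-double-count w I (All.map proj₁ tour-sizes)
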